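{- Let $d$ be a positive integer and fix a $d$-RSK growth diagram on a Young diagram $F$. Let $p=(x,y)$ be a lattice point of $F$ whose assigned partition has length less than $d$. Then every cell of $\mathrm{Rect}_p$ satisfies the RSK local rule; moreover every cell of $\mathrm{Rect}_{(x+1,y)}$ and of $\mathrm{Rect}_{(x,y+1)}$ that belongs to $F$ satisfies the RSK local rule.
   Context: Partitions: finite weakly decreasing sequences of positive integers, $\lambda_i=0$ beyond the length $\ell(\lambda)$; $d$-partitions have $\ell(\lambda)\le d$; $\alpha\prec\beta$ (or $\beta\succ\alpha$) means $\beta_1\ge\alpha_1\ge\beta_2\ge\alpha_2\ge\cdots$. Young diagrams lie in the first quadrant, cells are unit squares with integer vertices (lattice points); $\mathrm{Rect}_p$ is the rectangle with lower-left corner the origin and upper-right corner $p$. For a cell with entry $m$ and corner partitions $\kappa$ (bottom-left), $\mu$ (top-left), $\nu$ (bottom-right), $\rho$ (top-right): the RSK local rule requires $\mu\succ\kappa\prec\nu$, $\mu\prec\rho\succ\nu$, $\rho_1=m+\max(\mu_1,\nu_1)$ and $\rho_i+\kappa_{i-1}=\min(\mu_{i-1},\nu_{i-1})+\max(\mu_i,\nu_i)$ for all $i\ge2$; the $d$-RSK local rule requires all four to be $d$-partitions, $\mu\succ\kappa\prec\nu$, $\mu\prec\rho\succ\nu$, $m=0$ or $\kappa_d=0$, $\rho_1+\kappa_d=m+\min(\mu_d,\nu_d)+\max(\mu_1,\nu_1)$ and $\rho_i+\kappa_{i-1}=\min(\mu_{i-1},\nu_{i-1})+\max(\mu_i,\nu_i)$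 for $2\le i\le d$. A $d$-RSK growth diagram on $F$: a filling of $F$ (nonnegative integer entries) and a $d$-partition at each lattice point, the empty partition at all lattice points on the axes, every cell satisfying the $d$-RSK local rule. -}

module Defs where

open import Data.Nat using (ℕ; zero; suc; pred; _+_; _≤_; _<_; _≥_; _⊔_; _⊓_)
open import Data.List using (List; []; _∷_; length)
open import Data.List.Relation.Unary.All using (All)
open import Data.List.Relation.Unary.Linked using (Linked)
open import Data.Product using (_×_; ∃; ∃₂; _,_)
open import Data.Sum using (_⊎_)
open import Relation.Binary.PropositionalEquality using (_≡_)

IsPartition : List ℕ → Set
IsPartition λ′ = All (λ x → 0 < x) λ′ × Linked _≥_ λ′

-- part λ i = λ_i for i ≥ 1 (1-based), and 0 beyond the length.
-- (The value at index 0 is a dummy 0 and is never used.)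
part : List ℕ → ℕ → ℕ
part []       _             = 0
part (x ∷ xs) zero          = 0
part (x ∷ xs) (suc zero)    = x
part (x ∷ xs) (suc (suc n)) = part xs (suc n)

IsDPartition : ℕ → List ℕ → Set
IsDPartition d λ′ = IsPartition λ′ × length λ′ ≤ d

_≺_ : List ℕ → List ℕ → Set
α ≺ β = ∀ i → 1 ≤ i → (part α i ≤ part β i) × (part β (suc i) ≤ part α i)

-- RSK local rule for a cell with entry m and corners
-- κ (bottom-left), μ (top-left), ν (bottom-right), ρ (top-right).
RSKLocal : ℕ → List ℕ → List ℕ → List ℕ → List ℕ → Set
RSKLocal m κ μ ν ρ =
  (κ ≺ μ) × (κ ≺ ν) × (μ ≺ ρ) × (ν ≺ ρ)
  × (part ρ 1 ≡ m + (part μ 1 ⊔ part ν 1))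
  × (∀ i → 2 ≤ i →
       part ρ i + part κ (pred i)
         ≡ (part μ (pred i) ⊓ part ν (pred i)) + (part μ i ⊔ part ν i))

dRSKLocal : ℕ → ℕ → List ℕ → List ℕ → List ℕ → List ℕ → Set
dRSKLocal d m κ μ ν ρ =
  IsDPartition d κ × IsDPartition d μ × IsDPartition d ν × IsDPartition d ρ
  × (κ ≺ μ) × (κ ≺ ν) × (μ ≺ ρ) × (ν ≺ ρ)
  × (m ≡ 0 ⊎ part κ d ≡ 0)
  × (part ρ 1 + part κ d ≡ m + (part μ d ⊓ part ν d) + (part μ 1 ⊔ part ν 1))
  × (∀ i → 2 ≤ i → i ≤ d →
       part ρ i + part κ (pred i)
         ≡ (part μ (pred i) ⊓ part ν (pred i)) + (part μ i ⊔ part ν i))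

-- Young diagrams (French convention, first quadrant) are given by a partition F:
-- the cell with lower-left corner (i , j) belongs to F iff i < F_{j+1}.
InF : List ℕ → ℕ → ℕ → Set
InF F i j = i < part F (suc j)

LatticePt : List ℕ → ℕ → ℕ → Set
LatticePt F x y =
  ∃₂ λ i j → InF F i j × ((x ≡ i) ⊎ (x ≡ suc i)) × ((y ≡ j) ⊎ (y ≡ suc j))

-- A d-RSK growth diagram on F: filling f (entry of the cell with lower-left
-- corner (i , j)) and partitions P x y at lattice points (x , y).
record GrowthDiagram (d : ℕ) (F : List ℕ) (f : ℕ → ℕ → ℕ) (P : ℕ → ℕ → List ℕ) : Set where
  field
    dpart  : ∀ x y → LatticePt F x y → IsDPartition d (P x y)
    axisX  : ∀ x → LatticePt F x 0 → P x 0 ≡ []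
    axisY  : ∀ y → LatticePt F 0 y → P 0 y ≡ []
    local  : ∀ i j → InF F i j →
               dRSKLocal d (f i j) (P i j) (P i (suc j)) (P (suc i) j) (P (suc i) (suc j))

CellRSK : (ℕ → ℕ → ℕ) → (ℕ → ℕ → List ℕ) → ℕ → ℕ → Set
CellRSK f P i j = RSKLocal (f i j) (P i j) (P i (suc j)) (P (suc i) j) (P (suc i) (suc j))

-- The d-th part can only grow along a d-RSK growth diagram, since μ ≺ ρ and ν ≺ ρ give
-- μ_d ≤ ρ_d ≥ ν_d at every cell. Hence if ℓ(P(p)) < d, i.e. P(p)_d = 0, the top-left (or
-- bottom-right) corner of every cell of Rect_p, and of the cells in the adjoining column
-- and row, has vanishing d-th part (on the axes it is empty). Then min(μ_d, ν_d) = 0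
-- forces κ_d = 0, which turns the first d-RSK equation into the RSK one, and makes all
-- RSK equations with index i > d read 0 = 0.
module Submission where

open import Defs
open import Data.Nat using (ℕ; zero; suc; pred; _+_; _<_; _≤_; _≥_; _⊓_; _⊔_; z≤n; s≤s; _≤?_; _≤′_; ≤′-refl; ≤′-step)
open import Data.Nat.Properties
open import Data.List using (List; []; _∷_; length)
open import Data.List.Relation.Unary.Linked using (Linked; [-]; _∷_; tail)
open import Data.Product using (_×_; _,_; proj₁)
open import Data.Sum using (_⊎_; inj₁; inj₂)
open import Relation.Nullary using (yes; no)
open import Relation.Binary.PropositionalEquality

part-beyond-length : ∀ l k → length l < k → part l k ≡ 0
part-beyond-length []       k             _         = refl
part-beyond-length (x ∷ xs) (suc (suc k)) (s≤s l<k) = part-beyond-length xs (suc k) l<k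

head-≥-second-part : ∀ {x xs} → Linked _≥_ (x ∷ xs) → part xs 1 ≤ x
head-≥-second-part [-]       = z≤n
head-≥-second-part (x≥y ∷ _) = x≥y

part-antitone : ∀ {l j k} → Linked _≥_ l → 1 ≤ j → j ≤ k → part l k ≤ part l j
part-antitone {[]}                               _ _ _ = z≤n
part-antitone {x ∷ xs} {suc zero}    {suc zero}    _ _ _ = ≤-refl
part-antitone {x ∷ xs} {suc zero}    {suc (suc k)} L _ _ =
  ≤-trans (part-antitone (tail L) (s≤s z≤n) (s≤s z≤n)) (head-≥-second-part L)
part-antitone {x ∷ xs} {suc (suc j)} {suc (suc k)} L _ (s≤s j≤k) =
  part-antitone (tail L) (s≤s z≤n) j≤k

part-vanishes-beyond : ∀ {l j k} → Linked _≥_ l → 1 ≤ j → part l j ≡ 0 → j ≤ k → part l k ≡ 0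
part-vanishes-beyond {l} L 1≤j lj≡0 j≤k =
  n≤0⇒n≡0 (subst (part l _ ≤_) lj≡0 (part-antitone L 1≤j j≤k))

Rect⊆F : List ℕ → ℕ → ℕ → Set
Rect⊆F F x y = ∀ i j → i < x → j < y → InF F i j

LatticePt⇒Rect⊆F : ∀ {F x y} → IsPartition F → LatticePt F x y → Rect⊆F F x y
LatticePt⇒Rect⊆F (_ , L) (a , b , a<Fb , x≡a⊎1+a , y≡b⊎1+b) i j i<x j<y =
  <-≤-trans (≤-<-trans (below x≡a⊎1+a i<x) a<Fb)
            (part-antitone L (s≤s z≤n) (s≤s (below y≡b⊎1+b j<y)))
  where
  below : ∀ {n c m} → n ≡ c ⊎ n ≡ suc c → m < n → m ≤ c
  below (inj₁ refl) m<n = <⇒≤ m<n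
  below (inj₂ refl) m<n = ≤-pred m<n

≺-part-≤ : ∀ α β {k} → α ≺ β → 1 ≤ k → part α k ≤ part β k
≺-part-≤ _ _ α≺β 1≤k = proj₁ (α≺β _ 1≤k)

module _ {d m : ℕ} {κ μ ν ρ : List ℕ} where

  top-left≺top-right : dRSKLocal d m κ μ ν ρ → μ ≺ ρ
  top-left≺top-right (_ , _ , _ , _ , _ , _ , μ≺ρ , _) = μ≺ρ

  bottom-right≺top-right : dRSKLocal d m κ μ ν ρ → ν ≺ ρ
  bottom-right≺top-right (_ , _ , _ , _ , _ , _ , _ , ν≺ρ , _) = ν≺ρ

  dRSK⇒RSK : 1 ≤ d → part μ d ⊓ part ν d ≡ 0 → dRSKLocal d m κ μ ν ρ → RSKLocal m κ μ ν ρ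
  dRSK⇒RSK 1≤d min≡0
    ((( _ , κL) , _) , ((_ , μL) , μ-len) , ((_ , νL) , ν-len) , (_ , ρ-len)
    , κ≺μ , κ≺ν , μ≺ρ , ν≺ρ , _ , first , middle)
    = κ≺μ , κ≺ν , μ≺ρ , ν≺ρ , first′ , middle′
    where
    open ≡-Reasoning

    κd≡0 : part κ d ≡ 0
    κd≡0 = n≤0⇒n≡0 (subst (part κ d ≤_) min≡0 (⊓-glb (≺-part-≤ κ μ κ≺μ 1≤d) (≺-part-≤ κ ν κ≺ν 1≤d)))

    first′ : part ρ 1 ≡ m + (part μ 1 ⊔ part ν 1)
    first′ = begin
      part ρ 1                                           ≡⟨ sym (+-identityʳ _) ⟩
      part ρ 1 + 0                                       ≡⟨ cong (part ρ 1 +_) (sym κd≡0) ⟩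
      part ρ 1 + part κ d                                ≡⟨ first ⟩
      m + (part μ d ⊓ part ν d) + (part μ 1 ⊔ part ν 1)  ≡⟨ cong (λ t → m + t + (part μ 1 ⊔ part ν 1)) min≡0 ⟩
      m + 0 + (part μ 1 ⊔ part ν 1)                      ≡⟨ cong (_+ (part μ 1 ⊔ part ν 1)) (+-identityʳ m) ⟩
      m + (part μ 1 ⊔ part ν 1)                          ∎

    min-vanishes-beyond : ∀ {k} → d ≤ k → part μ k ⊓ part ν k ≡ 0
    min-vanishes-beyond d≤k = n≤0⇒n≡0 (subst (_ ≤_) min≡0
      (⊓-mono-≤ (part-antitone μL 1≤d d≤k) (part-antitone νL 1≤d d≤k)))

    middle′ : ∀ i → 2 ≤ i →
      part ρ i + part κ (pred i) ≡ (part μ (pred i) ⊓ part ν (pred i)) + (part μ i ⊔ part ν i)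
    middle′ i 2≤i with i ≤? d
    ... | yes i≤d = middle i 2≤i i≤d
    ... | no i≰d = begin
      part ρ i + part κ (pred i)
        ≡⟨ cong₂ _+_ (beyond ρ ρ-len) (part-vanishes-beyond κL 1≤d κd≡0 d≤i-1) ⟩
      0 + (0 ⊔ 0)
        ≡⟨ cong₂ _+_ (sym (min-vanishes-beyond d≤i-1)) (sym (cong₂ _⊔_ (beyond μ μ-len) (beyond ν ν-len))) ⟩
      (part μ (pred i) ⊓ part ν (pred i)) + (part μ i ⊔ part ν i) ∎
      where
      d<i : d < i
      d<i = ≰⇒> i≰d
      d≤i-1 : d ≤ pred i
      d≤i-1 = <⇒≤pred d<i
      beyond : ∀ l → length l ≤ d → part l i ≡ 0
      beyond l len≤d = part-beyond-length l i (≤-<-trans len≤d d<i)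

module _ {d F f P} (1≤d : 1 ≤ d) (G : GrowthDiagram d F f P) where
  open GrowthDiagram G

  top-left-part-≤ : ∀ i j → InF F i j → part (P i (suc j)) d ≤ part (P (suc i) (suc j)) d
  top-left-part-≤ i j c =
    ≺-part-≤ (P i (suc j)) (P (suc i) (suc j)) (top-left≺top-right (local i j c)) 1≤d

  bottom-right-part-≤ : ∀ i j → InF F i j → part (P (suc i) j) d ≤ part (P (suc i) (suc j)) d
  bottom-right-part-≤ i j c =
    ≺-part-≤ (P (suc i) j) (P (suc i) (suc j)) (bottom-right≺top-right (local i j c)) 1≤d

  row-mono : ∀ {x y i k j} → Rect⊆F F x y → i ≤′ k → k < x → j < y →
             part (P (suc i) (suc j)) d ≤ part (P (suc k) (suc j)) d
  row-mono R ≤′-refl          _   _   = ≤-refl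
  row-mono {j = j} R (≤′-step {k} i≤′k) 1+k<x j<y =
    ≤-trans (row-mono R i≤′k (<⇒≤ 1+k<x) j<y) (top-left-part-≤ (suc k) j (R _ _ 1+k<x j<y))

  col-mono : ∀ {x y i j k} → Rect⊆F F x y → j ≤′ k → i < x → k < y →
             part (P (suc i) (suc j)) d ≤ part (P (suc i) (suc k)) d
  col-mono R ≤′-refl          _   _   = ≤-refl
  col-mono {i = i} R (≤′-step {k} j≤′k) i<x 1+k<y =
    ≤-trans (col-mono R j≤′k i<x (<⇒≤ 1+k<y)) (bottom-right-part-≤ i (suc k) (R _ _ i<x 1+k<y))

  part-≤-corner : ∀ {x y i j} → Rect⊆F F x y → i < x → j < y →
                  part (P (suc i) (suc j)) d ≤ part (P x y) d
  part-≤-corner {suc x} {suc y} R (s≤s i≤x) (s≤s j≤y) =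
    ≤-trans (row-mono R (≤⇒≤′ i≤x) ≤-refl (s≤s j≤y)) (col-mono R (≤⇒≤′ j≤y) ≤-refl ≤-refl)

  module _ {x y} (R : Rect⊆F F x y) (corner≡0 : part (P x y) d ≡ 0) where

    top-left-vanishes : ∀ {i j} → i ≤ x → j < y → InF F i j → part (P i (suc j)) d ≡ 0
    top-left-vanishes {zero}  {j} _   _   c =
      cong (λ l → part l d) (axisY (suc j) (0 , j , c , inj₁ refl , inj₂ refl))
    top-left-vanishes {suc i}     i<x j<y _ =
      n≤0⇒n≡0 (subst (_ ≤_) corner≡0 (part-≤-corner R i<x j<y))

    bottom-right-vanishes : ∀ {i j} → i < x → j ≤ y → InF F i j → part (P (suc i) j) d ≡ 0
    bottom-right-vanishes {i} {zero}      _   _   c =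
      cong (λ l → part l d) (axisX (suc i) (i , 0 , c , inj₂ refl , inj₁ refl))
    bottom-right-vanishes {j = suc j} i<x j<y _ =
      n≤0⇒n≡0 (subst (_ ≤_) corner≡0 (part-≤-corner R i<x j<y))

  RSK-if-top-left-vanishes : ∀ {i j} → InF F i j → part (P i (suc j)) d ≡ 0 → CellRSK f P i j
  RSK-if-top-left-vanishes {i} {j} c μd≡0 =
    dRSK⇒RSK 1≤d (cong (_⊓ part (P (suc i) j) d) μd≡0) (local i j c)

  RSK-if-bottom-right-vanishes : ∀ {i j} → InF F i j → part (P (suc i) j) d ≡ 0 → CellRSK f P i j
  RSK-if-bottom-right-vanishes {i} {j} c νd≡0 =
    dRSK⇒RSK 1≤d (trans (cong (part (P i (suc j)) d ⊓_) νd≡0) (⊓-zeroʳ _)) (local i j c)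

lemma5p1 : (d : ℕ) → 1 ≤ d → (F : List ℕ) → IsPartition F
    → (f : ℕ → ℕ → ℕ) → (P : ℕ → ℕ → List ℕ) → GrowthDiagram d F f P
    → (x y : ℕ) → LatticePt F x y → length (P x y) < d
    → (∀ i j → i < x → j < y → CellRSK f P i j)
    × (∀ i j → i < suc x → j < y → InF F i j → CellRSK f P i j)
    × (∀ i j → i < x → j < suc y → InF F i j → CellRSK f P i j)
lemma5p1 d 1≤d F F-partition f P G x y p ℓ<d = inside , right-column , top-row
  where
  R : Rect⊆F F x y
  R = LatticePt⇒Rect⊆F F-partition p
  corner≡0 : part (P x y) d ≡ 0
  corner≡0 = part-beyond-length (P x y) d ℓ<d

  right-column : ∀ i j → i < suc x → j < y → InF F i j → CellRSK f P i j
  right-column i j i<1+x j<y c =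
    RSK-if-top-left-vanishes 1≤d G c (top-left-vanishes 1≤d G R corner≡0 (≤-pred i<1+x) j<y c)

  top-row : ∀ i j → i < x → j < suc y → InF F i j → CellRSK f P i j
  top-row i j i<x j<1+y c =
    RSK-if-bottom-right-vanishes 1≤d G c (bottom-right-vanishes 1≤d G R corner≡0 i<x (≤-pred j<1+y) c)

  inside : ∀ i j → i < x → j < y → CellRSK f P i j
  inside i j i<x j<y = right-column i j (m<n⇒m<1+n i<x) j<y (R i j i<x j<y)
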